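{- Let $G=(V,E)$ be a finite simple undirected graph with $m=|E|\ge1$, $V_1,\dots,V_k$ a partition of $V$ into nonempty sets, $\psi\in\{\alpha,\phi\}$, $q\in[0,\tfrac12]$, and for $j\in[k]$, $e\in E$ let $F_j(e)=\frac{m}{|V_j|}\sum_{v\in V_j}\frac{a_q(v,e)}{|W^*_v|}$ with $a_q(v,e)=q|\Delta_e|\mathbf{1}[v\in e]+(1-2q)\mathbf{1}[v\in\mathcal{N}_e]$. For each edge $e=\{u,v\}$ choose $z=z(e)\in\arg\min\{d_u,d_v\}$ and set $$\widehat{R}_j(e)=\sum_{w\in\mathcal{N}_z\cap V_j}\frac{1-2q}{|W^*_w|}+q\frac{d_z}{|W^*_u|}\mathbf{1}[u\in V_j]+q\frac{d_z}{|W^*_v|}\mathbf{1}[v\in V_j],\qquad R_j=\max_{e\in E}\widehat{R}_j(e)\frac{m}{|V_j|}.$$ Then $F_j(e)\le R_j$ for every $e\in E$ and every $j\in[k]$.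
   Context: $\mathcal{N}_v$ is the neighborhood of $v$, $d_v=|\mathcal{N}_v|$; for $e=\{u,v\}$, $\mathcal{N}_e=\mathcal{N}_u\cap\mathcal{N}_v$; $\Delta_e$ is the set of triangles containing $e$. $|W^*_v|=\binom{d_v}{2}$ if $\psi=\alpha$ (local clustering coefficient) and $|W^*_v|=\frac12\sum_{u\in\mathcal{N}_v}(d_u-1)$ if $\psi=\phi$ (local closure coefficient); quotients with zero denominator are taken to be $0$. -}

module Defs where

open import Data.Bool using (Bool; true; false; if_then_else_; _∧_)
open import Data.Nat as ℕ using (ℕ; zero; suc; _∸_; _<ᵇ_)
open import Data.Fin using (Fin; toℕ; _≟_)
open import Data.List using (List; []; _∷_; length; concatMap; filter; allFin; foldr; map)
open import Data.Product using (_×_; _,_; proj₁; proj₂)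
open import Data.Integer using (+_)
open import Data.Rational using (ℚ; 0ℚ; 1ℚ; ½; _+_; _*_; _-_; 1/_; _⊔_; _/_; ≢-nonZero)
import Data.Rational.Properties as ℚP
open import Relation.Nullary using (yes; no; does)

-- A finite simple undirected graph on vertex set Fin n, given by a Bool adjacency
-- matrix; symmetry and irreflexivity are hypotheses of the theorem.
Adj : ℕ → Set
Adj n = Fin n → Fin n → Bool

ι : ℕ → ℚ
ι k = + k / 1

Σ : ∀ {n} → (Fin n → ℚ) → ℚ
Σ {n} f = foldr (λ x acc → f x + acc) 0ℚ (allFin n)

count : ∀ {n} → (Fin n → Bool) → ℕ
count {n} p = length (filter (λ x → Data.Bool._≟_ (p x) true) (allFin n))

𝟙 : Bool → ℚ
𝟙 true = 1ℚ
𝟙 false = 0ℚ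

-- division with the convention x / 0 = 0
_÷₀_ : ℚ → ℚ → ℚ
x ÷₀ y with y ℚP.≟ 0ℚ
... | yes _ = 0ℚ
... | no y≢0 = x * (1/_ y {{≢-nonZero y≢0}})

-- edge set E: unordered pairs {u,v}, each listed once as (u , v) with u < v
edges : ∀ {n} → Adj n → List (Fin n × Fin n)
edges {n} adj =
  concatMap (λ u → map (λ v → (u , v))
    (filter (λ v → Data.Bool._≟_ ((toℕ u <ᵇ toℕ v) ∧ adj u v) true) (allFin n)))
    (allFin n)

numEdges : ∀ {n} → Adj n → ℕ
numEdges adj = length (edges adj)

deg : ∀ {n} → Adj n → Fin n → ℕ
deg adj v = count (adj v)

inEdge : ∀ {n} → Fin n → Fin n × Fin n → Bool
inEdge v (u , w) = does (v ≟ u) Data.Bool.∨ does (v ≟ w)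

inNe : ∀ {n} → Adj n → Fin n → Fin n × Fin n → Bool
inNe adj v (u , w) = adj u v ∧ adj w v

-- |Δ_e| = number of triangles containing e = |N_e|
numTri : ∀ {n} → Adj n → Fin n × Fin n → ℕ
numTri adj e = count (λ v → inNe adj v e)

data Psi : Set where
  α φ : Psi

W* : ∀ {n} → Psi → Adj n → Fin n → ℚ
W* α adj v = ι (deg adj v ℕ.* (deg adj v ∸ 1)) * ½
W* φ adj v = ½ * Σ (λ u → if adj v u then ι (deg adj u ∸ 1) else 0ℚ)

-- block V_j of the partition given by part : Fin n → Fin k
inBlock : ∀ {n k} → (Fin n → Fin k) → Fin k → Fin n → Bool
inBlock part j v = does (part v ≟ j)

aq : ∀ {n} → Adj n → ℚ → Fin n → Fin n × Fin n → ℚ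
aq adj q v e = q * ι (numTri adj e) * 𝟙 (inEdge v e)
             + (1ℚ - (q + q)) * 𝟙 (inNe adj v e)

F : ∀ {n k} → Psi → Adj n → (Fin n → Fin k) → ℚ → Fin k → Fin n × Fin n → ℚ
F ψ adj part q j e =
  (ι (numEdges adj) ÷₀ ι (count (inBlock part j)))
  * Σ (λ v → 𝟙 (inBlock part j v) * (aq adj q v e ÷₀ W* ψ adj v))

-- R̂_j(e), with z = z u v the chosen minimum-degree endpoint of e = {u,v}
Rhat : ∀ {n k} → Psi → Adj n → (Fin n → Fin k) → ℚ → (Fin n → Fin n → Fin n)
     → Fin k → Fin n × Fin n → ℚ
Rhat ψ adj part q z j (u , v) =
  Σ (λ w → 𝟙 (adj (z u v) w ∧ inBlock part j w) * ((1ℚ - (q + q)) ÷₀ W* ψ adj w))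
  + q * (ι (deg adj (z u v)) ÷₀ W* ψ adj u) * 𝟙 (inBlock part j u)
  + q * (ι (deg adj (z u v)) ÷₀ W* ψ adj v) * 𝟙 (inBlock part j v)

-- maximum of a list of rationals (the list will be nonempty since m ≥ 1)
maxList : List ℚ → ℚ
maxList [] = 0ℚ
maxList (x ∷ []) = x
maxList (x ∷ y ∷ xs) = x ⊔ maxList (y ∷ xs)

R : ∀ {n k} → Psi → Adj n → (Fin n → Fin k) → ℚ → (Fin n → Fin n → Fin n) → Fin k → ℚ
R ψ adj part q z j =
  maxList (map (λ e → Rhat ψ adj part q z j e * (ι (numEdges adj) ÷₀ ι (count (inBlock part j))))
               (edges adj))

{-# OPTIONS --safe #-}

-- Up to the common factor m/|V_j| ≥ 0, both F_j(e) and R̂_j(e) are sums over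
-- the vertices w ∈ V_j, once the two endpoint terms of R̂_j(e) are attributed
-- to w = u and w = v; we compare them term by term.  The summand a_q(w,e)
-- splits into q|Δ_e|·1[w ∈ e] and (1-2q)·1[w ∈ N_e].  Since z is an endpoint
-- of e, N_e ⊆ N_z, which bounds the second part by the N_z-term of R̂_j(e), and
-- gives |Δ_e| = |N_e| ≤ d_z, which together with 1[w ∈ e] ≤ 1[w = u] + 1[w = v]
-- bounds the first part by the endpoint terms.

module Submission where

open import Defs
open import Data.Bool using (Bool; true; false)
open import Data.Nat using (ℕ; _≤_)
open import Data.Fin using (Fin)
open import Data.Product using (_×_; _,_; ∃)
open import Data.Sum using (_⊎_)
open import Data.List.Membership.Propositional using (_∈_)
open import Data.Rational using (ℚ; 0ℚ; ½) renaming (_≤_ to _≤ℚ_)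
open import Relation.Binary.PropositionalEquality using (_≡_)

open import Algebra.Bundles using (CommutativeMonoid)
open import Data.Bool using (_∧_; _∨_; if_then_else_)
open import Data.Bool.Properties using (∧-conicalˡ; ∧-conicalʳ) renaming (_≟_ to _≟ᵇ_)
open import Data.Fin using (zero; suc; toℕ; _≟_)
import Data.Integer as ℤ
import Data.Integer.Properties as ℤP
open import Data.List using (List; []; _∷_; foldr; allFin)
open import Data.List.Properties using (foldr-map; map-tabulate)
open import Data.List.Membership.Propositional.Properties
  using (∈-concatMap⁻; ∈-map⁻; ∈-map⁺; ∈-filter⁻)
open import Data.List.Relation.Unary.Any using (here; there; satisfied)
open import Data.List.Relation.Binary.Sublist.Propositional using (⊆-refl)
open import Data.List.Relation.Binary.Sublist.Propositional.Properties
  using (filter⁺; length-mono-≤)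
import Data.Nat as ℕ
import Data.Nat.Coprimality as Coprime
open import Data.Product using (proj₁; proj₂)
open import Data.Rational
  using (mkℚ; _+_; _*_; _-_; -_; 1ℚ; 1/_; *≤*; Positive; nonNegative; ≢-nonZero)
import Data.Rational.Properties as ℚP
open import Data.Rational.Solver using (module +-*-Solver)
open import Data.Sum using (inj₁; inj₂)
open import Function using (id)
open import Relation.Binary.PropositionalEquality
  using (refl; sym; trans; cong; cong₂; subst; module ≡-Reasoning)
open import Relation.Nullary using (Dec; yes; no; does)

open import Algebra.Properties.CommutativeSemigroup
  (CommutativeMonoid.commutativeSemigroup ℚP.+-0-commutativeMonoid) using (interchange)

-- Σ f is definitionally sumBy f (allFin n).
sumBy : {A : Set} → (A → ℚ) → List A → ℚ
sumBy f = foldr (λ x acc → f x + acc) 0ℚ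

module _ {A : Set} where

  sumBy-mono-≤ : {f g : A → ℚ} → (∀ x → f x ≤ℚ g x) → ∀ xs → sumBy f xs ≤ℚ sumBy g xs
  sumBy-mono-≤ f≤g []       = ℚP.≤-refl
  sumBy-mono-≤ f≤g (x ∷ xs) = ℚP.+-mono-≤ (f≤g x) (sumBy-mono-≤ f≤g xs)

  sumBy-nonNeg : {f : A → ℚ} → (∀ x → 0ℚ ≤ℚ f x) → ∀ xs → 0ℚ ≤ℚ sumBy f xs
  sumBy-nonNeg 0≤f []       = ℚP.≤-refl
  sumBy-nonNeg 0≤f (x ∷ xs) = ℚP.+-mono-≤ (0≤f x) (sumBy-nonNeg 0≤f xs)

  sumBy-zero : {f : A → ℚ} → (∀ x → f x ≡ 0ℚ) → ∀ xs → sumBy f xs ≡ 0ℚ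
  sumBy-zero f≡0 []       = refl
  sumBy-zero f≡0 (x ∷ xs) = cong₂ _+_ (f≡0 x) (sumBy-zero f≡0 xs)

  sumBy-distrib-+ : (f g : A → ℚ) → ∀ xs → sumBy (λ x → f x + g x) xs ≡ sumBy f xs + sumBy g xs
  sumBy-distrib-+ f g []       = refl
  sumBy-distrib-+ f g (x ∷ xs) =
    trans (cong ((f x + g x) +_) (sumBy-distrib-+ f g xs)) (interchange (f x) (g x) _ _)

Σ-suc : ∀ {n} (f : Fin (ℕ.suc n) → ℚ) → Σ f ≡ f zero + Σ (λ i → f (suc i))
Σ-suc {n} f = cong (f zero +_)
  (trans (cong (sumBy f) (sym (map-tabulate id suc))) (foldr-map _ suc 0ℚ (allFin n)))

Σ-𝟙-≟ : ∀ {n} (u : Fin n) (c : ℚ) → Σ (λ w → 𝟙 (does (w ≟ u)) * c) ≡ c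
Σ-𝟙-≟ {ℕ.suc n} zero c = begin
  Σ δ                           ≡⟨ Σ-suc δ ⟩
  1ℚ * c + Σ {n} (λ _ → 0ℚ * c) ≡⟨ cong₂ _+_ (ℚP.*-identityˡ c)
                                             (sumBy-zero (λ _ → ℚP.*-zeroˡ c) (allFin n)) ⟩
  c + 0ℚ                        ≡⟨ ℚP.+-identityʳ c ⟩
  c                             ∎
  where
  open ≡-Reasoning
  δ : Fin (ℕ.suc n) → ℚ
  δ w = 𝟙 (does (w ≟ zero)) * c
Σ-𝟙-≟ {ℕ.suc n} (suc u) c = begin
  Σ (λ w → 𝟙 (does (w ≟ suc u)) * c)       ≡⟨ Σ-suc (λ w → 𝟙 (does (w ≟ suc u)) * c) ⟩
  0ℚ * c + Σ (λ w → 𝟙 (does (w ≟ u)) * c)   ≡⟨ cong₂ _+_ (ℚP.*-zeroˡ c) (Σ-𝟙-≟ u c) ⟩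
  0ℚ + c                                    ≡⟨ ℚP.+-identityˡ c ⟩
  c                                         ∎
  where open ≡-Reasoning

𝟙-nonNeg : ∀ b → 0ℚ ≤ℚ 𝟙 b
𝟙-nonNeg true  = *≤* (ℤ.+≤+ ℕ.z≤n)
𝟙-nonNeg false = ℚP.≤-refl

𝟙-mono-≤ : ∀ {a b} → (a ≡ true → b ≡ true) → 𝟙 a ≤ℚ 𝟙 b
𝟙-mono-≤ {false} {b} _ = 𝟙-nonNeg b
𝟙-mono-≤ {true}  a⇒b rewrite a⇒b refl = ℚP.≤-refl

𝟙-∨-≤ : ∀ a b → 𝟙 (a ∨ b) ≤ℚ 𝟙 a + 𝟙 b
𝟙-∨-≤ true  b = ℚP.+-mono-≤ ℚP.≤-refl (𝟙-nonNeg b)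
𝟙-∨-≤ false b = ℚP.≤-reflexive (sym (ℚP.+-identityˡ (𝟙 b)))

𝟙-∧ : ∀ a b → 𝟙 (a ∧ b) ≡ 𝟙 a * 𝟙 b
𝟙-∧ true  b = sym (ℚP.*-identityˡ (𝟙 b))
𝟙-∧ false b = sym (ℚP.*-zeroˡ (𝟙 b))

𝟙-≟-*-subst : ∀ {n} (h : Fin n → ℚ) w u → 𝟙 (does (w ≟ u)) * h w ≡ 𝟙 (does (w ≟ u)) * h u
𝟙-≟-*-subst h w u with w ≟ u
... | yes refl = refl
... | no _     = trans (ℚP.*-zeroˡ (h w)) (sym (ℚP.*-zeroˡ (h u)))

*-nonNeg : ∀ {a b} → 0ℚ ≤ℚ a → 0ℚ ≤ℚ b → 0ℚ ≤ℚ a * b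
*-nonNeg {a} {b} 0≤a 0≤b =
  ℚP.nonNegative⁻¹ _ {{ℚP.nonNeg*nonNeg⇒nonNeg a {{nonNegative 0≤a}} b {{nonNegative 0≤b}}}}

*-mono-≤-nonNeg : ∀ {a b c d} → 0ℚ ≤ℚ b → 0ℚ ≤ℚ c → a ≤ℚ b → c ≤ℚ d → a * c ≤ℚ b * d
*-mono-≤-nonNeg {b = b} {c} 0≤b 0≤c a≤b c≤d = ℚP.≤-trans
  (ℚP.*-monoʳ-≤-nonNeg c {{nonNegative 0≤c}} a≤b) (ℚP.*-monoˡ-≤-nonNeg b {{nonNegative 0≤b}} c≤d)

p≤q⇒0≤q-p : ∀ {p q} → p ≤ℚ q → 0ℚ ≤ℚ q - p
p≤q⇒0≤q-p {p} {q} p≤q = subst (_≤ℚ q - p) (ℚP.+-inverseʳ p) (ℚP.+-monoˡ-≤ (- p) p≤q)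

1/₀_ : ℚ → ℚ
1/₀ y with y ℚP.≟ 0ℚ
... | yes _   = 0ℚ
... | no y≢0 = 1/_ y {{≢-nonZero y≢0}}

÷₀≡*1/₀ : ∀ x y → x ÷₀ y ≡ x * 1/₀ y
÷₀≡*1/₀ x y with y ℚP.≟ 0ℚ
... | yes _ = sym (ℚP.*-zeroʳ x)
... | no _  = refl

1/₀-nonNeg : ∀ {y} → 0ℚ ≤ℚ y → 0ℚ ≤ℚ 1/₀ y
1/₀-nonNeg {y} 0≤y with y ℚP.≟ 0ℚ
... | yes _   = ℚP.≤-refl
... | no y≢0 = ℚP.<⇒≤ (ℚP.positive⁻¹ _ {{ℚP.1/pos⇒pos y {{y>0}}}})
  where
  y>0 : Positive y
  y>0 = ℚP.nonNeg∧nonZero⇒pos y {{nonNegative 0≤y}} {{≢-nonZero y≢0}}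

÷₀-nonNeg : ∀ {x y} → 0ℚ ≤ℚ x → 0ℚ ≤ℚ y → 0ℚ ≤ℚ x ÷₀ y
÷₀-nonNeg {x} {y} 0≤x 0≤y rewrite ÷₀≡*1/₀ x y = *-nonNeg 0≤x (1/₀-nonNeg 0≤y)

ι≡mkℚ : ∀ k → ι k ≡ mkℚ (ℤ.+ k) 0 (Coprime.sym (Coprime.1-coprimeTo k))
ι≡mkℚ k = ℚP.normalize-coprime (Coprime.sym (Coprime.1-coprimeTo k))

ι-mono-≤ : ∀ {m n} → m ≤ n → ι m ≤ℚ ι n
ι-mono-≤ {m} {n} m≤n rewrite ι≡mkℚ m | ι≡mkℚ n = *≤* (ℤP.*-monoʳ-≤-nonNeg (ℤ.+ 1) (ℤ.+≤+ m≤n))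

ι-nonNeg : ∀ k → 0ℚ ≤ℚ ι k
ι-nonNeg k = ι-mono-≤ {0} {k} ℕ.z≤n

0≤½ : 0ℚ ≤ℚ ½
0≤½ = *≤* (ℤ.+≤+ ℕ.z≤n)

W*-nonNeg : ∀ {n} ψ (adj : Adj n) w → 0ℚ ≤ℚ W* ψ adj w
W*-nonNeg α adj w = *-nonNeg (ι-nonNeg (deg adj w ℕ.* (deg adj w ℕ.∸ 1))) 0≤½
W*-nonNeg {n} φ adj w = *-nonNeg 0≤½ (sumBy-nonNeg neighbourTerm-nonNeg (allFin n))
  where
  neighbourTerm-nonNeg : ∀ u → 0ℚ ≤ℚ (if adj w u then ι (deg adj u ℕ.∸ 1) else 0ℚ)
  neighbourTerm-nonNeg u with adj w u
  ... | true  = ι-nonNeg (deg adj u ℕ.∸ 1)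
  ... | false = ℚP.≤-refl

∈-edges⇒adj : ∀ {n} (adj : Adj n) {u v} → (u , v) ∈ edges adj → adj u v ≡ true
∈-edges⇒adj {n} adj e∈E with satisfied (∈-concatMap⁻ _ {xs = allFin n} e∈E)
... | u , e∈row with ∈-map⁻ (λ v → (u , v)) e∈row
... | v , v∈filter , refl = ∧-conicalʳ _ _ (proj₂ (∈-filter⁻ isEdge? {xs = allFin n} v∈filter))
  where
  isEdge? : ∀ v → Dec (((toℕ u ℕ.<ᵇ toℕ v) ∧ adj u v) ≡ true)
  isEdge? v = ((toℕ u ℕ.<ᵇ toℕ v) ∧ adj u v) ≟ᵇ true

inNe⇒adj-endpoint : ∀ {n} (adj : Adj n) {u v x w} → x ≡ u ⊎ x ≡ v →
                    inNe adj w (u , v) ≡ true → adj x w ≡ true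
inNe⇒adj-endpoint adj {u} {v} {w = w} (inj₁ refl) = ∧-conicalˡ (adj u w) (adj v w)
inNe⇒adj-endpoint adj {u} {v} {w = w} (inj₂ refl) = ∧-conicalʳ (adj u w) (adj v w)

numTri≤deg-endpoint : ∀ {n} (adj : Adj n) {u v x} → x ≡ u ⊎ x ≡ v →
                      numTri adj (u , v) ≤ deg adj x
numTri≤deg-endpoint {n} adj {u} {v} {x} x∈e = length-mono-≤
  (filter⁺ (λ w → inNe adj w (u , v) ≟ᵇ true) (λ w → adj x w ≟ᵇ true)
           (λ { refl → inNe⇒adj-endpoint adj x∈e }) (⊆-refl {x = allFin n}))

≤-maxList : ∀ {x xs} → x ∈ xs → x ≤ℚ maxList xs
≤-maxList {xs = _ ∷ []}    (here refl) = ℚP.≤-refl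
≤-maxList {xs = x ∷ _ ∷ _} (here refl) = ℚP.p≤p⊔q x _
≤-maxList {xs = y ∷ _ ∷ _} (there x∈xs) = ℚP.p≤q⇒p≤r⊔q y (≤-maxList x∈xs)

expand-F-summand : ∀ q t p E N B I →
  B * ((q * t * E + p * N) * I) ≡ q * t * (E * (B * I)) + p * (N * (B * I))
expand-F-summand = solve 7 (λ q t p E N B I →
  B :* ((q :* t :* E :+ p :* N) :* I) := q :* t :* (E :* (B :* I)) :+ p :* (N :* (B :* I))) refl
  where open +-*-Solver

collect-Rhat-summand : ∀ q d p Z B I δu Bu Iu δv Bv Iv →
  q * d * (δu * (Bu * Iu) + δv * (Bv * Iv)) + p * (Z * (B * I))
    ≡ Z * B * (p * I) + δu * (q * (d * Iu) * Bu) + δv * (q * (d * Iv) * Bv)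
collect-Rhat-summand = solve 12 (λ q d p Z B I δu Bu Iu δv Bv Iv →
  q :* d :* (δu :* (Bu :* Iu) :+ δv :* (Bv :* Iv)) :+ p :* (Z :* (B :* I))
    := Z :* B :* (p :* I) :+ δu :* (q :* (d :* Iu) :* Bu) :+ δv :* (q :* (d :* Iv) :* Bv)) refl
  where open +-*-Solver

module _ {n k} (adj : Adj n) (part : Fin n → Fin k) (ψ : Psi) (q : ℚ) (j : Fin k) where

  F-term : Fin n × Fin n → Fin n → ℚ
  F-term e w = 𝟙 (inBlock part j w) * (aq adj q w e ÷₀ W* ψ adj w)

  Rhat-term : Fin n → Fin n × Fin n → Fin n → ℚ
  Rhat-term x (u , v) w =
    𝟙 (adj x w ∧ inBlock part j w) * ((1ℚ - (q + q)) ÷₀ W* ψ adj w)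
    + 𝟙 (does (w ≟ u)) * (q * (ι (deg adj x) ÷₀ W* ψ adj u) * 𝟙 (inBlock part j u))
    + 𝟙 (does (w ≟ v)) * (q * (ι (deg adj x) ÷₀ W* ψ adj v) * 𝟙 (inBlock part j v))

  Σ-Rhat-term : ∀ z u v → Σ (Rhat-term (z u v) (u , v)) ≡ Rhat ψ adj part q z j (u , v)
  Σ-Rhat-term z u v = begin
    Σ (λ w → g w + δ u w + δ v w)   ≡⟨ sumBy-distrib-+ (λ w → g w + δ u w) (δ v) (allFin n) ⟩
    Σ (λ w → g w + δ u w) + Σ (δ v) ≡⟨ cong (_+ Σ (δ v)) (sumBy-distrib-+ g (δ u) (allFin n)) ⟩
    Σ g + Σ (δ u) + Σ (δ v)         ≡⟨ cong₂ (λ a b → Σ g + a + b) (Σ-𝟙-≟ u (c u)) (Σ-𝟙-≟ v (c v)) ⟩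
    Σ g + c u + c v                 ∎
    where
    open ≡-Reasoning
    g : Fin n → ℚ
    g w = 𝟙 (adj (z u v) w ∧ inBlock part j w) * ((1ℚ - (q + q)) ÷₀ W* ψ adj w)
    c : Fin n → ℚ
    c y = q * (ι (deg adj (z u v)) ÷₀ W* ψ adj y) * 𝟙 (inBlock part j y)
    δ : Fin n → Fin n → ℚ
    δ y w = 𝟙 (does (w ≟ y)) * c y

  F-term≤Rhat-term : 0ℚ ≤ℚ q → q ≤ℚ ½ → ∀ {u v x} → x ≡ u ⊎ x ≡ v → ∀ w →
                     F-term (u , v) w ≤ℚ Rhat-term x (u , v) w
  F-term≤Rhat-term 0≤q q≤½ {u} {v} {x} x∈e w
    rewrite ÷₀≡*1/₀ (aq adj q w (u , v)) (W* ψ adj w) | ÷₀≡*1/₀ (1ℚ - (q + q)) (W* ψ adj w)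
          | ÷₀≡*1/₀ (ι (deg adj x)) (W* ψ adj u) | ÷₀≡*1/₀ (ι (deg adj x)) (W* ψ adj v)
          | 𝟙-∧ (adj x w) (inBlock part j w) = begin
    B w * ((q * t * E + p * N) * I w)
      ≡⟨ expand-F-summand q t p E N (B w) (I w) ⟩
    q * t * (E * BI w) + p * (N * BI w)
      ≤⟨ ℚP.+-mono-≤ edge-part≤ neighbour-part≤ ⟩
    q * d * ((δ u + δ v) * BI w) + p * (Z * BI w)
      ≡⟨ cong (λ y → q * d * y + p * (Z * BI w)) localise ⟩
    q * d * (δ u * BI u + δ v * BI v) + p * (Z * BI w)
      ≡⟨ collect-Rhat-summand q d p Z (B w) (I w) (δ u) (B u) (I u) (δ v) (B v) (I v) ⟩
    Z * B w * (p * I w) + δ u * (q * (d * I u) * B u) + δ v * (q * (d * I v) * B v) ∎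
    where
    open ℚP.≤-Reasoning
    p t d E N Z : ℚ
    p = 1ℚ - (q + q)
    t = ι (numTri adj (u , v))
    d = ι (deg adj x)
    E = 𝟙 (inEdge w (u , v))
    N = 𝟙 (inNe adj w (u , v))
    Z = 𝟙 (adj x w)
    B : Fin n → ℚ
    B y = 𝟙 (inBlock part j y)
    I : Fin n → ℚ
    I y = 1/₀ W* ψ adj y
    BI : Fin n → ℚ
    BI y = B y * I y
    δ : Fin n → ℚ
    δ y = 𝟙 (does (w ≟ y))

    0≤p : 0ℚ ≤ℚ p
    0≤p = p≤q⇒0≤q-p (ℚP.+-mono-≤ q≤½ q≤½)

    0≤BI : 0ℚ ≤ℚ BI w
    0≤BI = *-nonNeg (𝟙-nonNeg (inBlock part j w)) (1/₀-nonNeg (W*-nonNeg ψ adj w))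

    edge-part≤ : q * t * (E * BI w) ≤ℚ q * d * ((δ u + δ v) * BI w)
    edge-part≤ = *-mono-≤-nonNeg
      (*-nonNeg 0≤q (ι-nonNeg (deg adj x))) (*-nonNeg (𝟙-nonNeg (inEdge w (u , v))) 0≤BI)
      (ℚP.*-monoˡ-≤-nonNeg q {{nonNegative 0≤q}} (ι-mono-≤ (numTri≤deg-endpoint adj x∈e)))
      (ℚP.*-monoʳ-≤-nonNeg (BI w) {{nonNegative 0≤BI}} (𝟙-∨-≤ (does (w ≟ u)) (does (w ≟ v))))

    neighbour-part≤ : p * (N * BI w) ≤ℚ p * (Z * BI w)
    neighbour-part≤ = ℚP.*-monoˡ-≤-nonNeg p {{nonNegative 0≤p}}
      (ℚP.*-monoʳ-≤-nonNeg (BI w) {{nonNegative 0≤BI}} (𝟙-mono-≤ (inNe⇒adj-endpoint adj x∈e)))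

    localise : (δ u + δ v) * BI w ≡ δ u * BI u + δ v * BI v
    localise = trans (ℚP.*-distribʳ-+ (BI w) (δ u) (δ v))
                     (cong₂ _+_ (𝟙-≟-*-subst BI w u) (𝟙-≟-*-subst BI w v))

lemma3p15 : ∀ {n k} (adj : Adj n)
    → (∀ u v → adj u v ≡ adj v u)
    → (∀ u → adj u u ≡ false)
    → 1 ≤ numEdges adj
    → (part : Fin n → Fin k)
    → (∀ j → ∃ λ v → part v ≡ j)
    → (ψ : Psi) (q : ℚ) → 0ℚ ≤ℚ q → q ≤ℚ ½
    → (z : Fin n → Fin n → Fin n)
    → (∀ u v → adj u v ≡ true →
         (z u v ≡ u ⊎ z u v ≡ v) × deg adj (z u v) ≤ deg adj u × deg adj (z u v) ≤ deg adj v)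
    → ∀ (j : Fin k) (e : Fin n × Fin n) → e ∈ edges adj
    → F ψ adj part q j e ≤ℚ R ψ adj part q z j
lemma3p15 {n} adj _ _ _ part _ ψ q 0≤q q≤½ z z-endpoint j (u , v) e∈E = begin
  c * Σ (F-term adj part ψ q j (u , v))
    ≤⟨ ℚP.*-monoˡ-≤-nonNeg c {{nonNegative 0≤c}}
         (sumBy-mono-≤ (F-term≤Rhat-term adj part ψ q j 0≤q q≤½ z∈e) (allFin n)) ⟩
  c * Σ (Rhat-term adj part ψ q j (z u v) (u , v))
    ≡⟨ cong (c *_) (Σ-Rhat-term adj part ψ q j z u v) ⟩
  c * Rhat ψ adj part q z j (u , v)
    ≡⟨ ℚP.*-comm c _ ⟩
  Rhat ψ adj part q z j (u , v) * c
    ≤⟨ ≤-maxList (∈-map⁺ (λ e → Rhat ψ adj part q z j e * c) e∈E) ⟩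
  R ψ adj part q z j ∎
  where
  open ℚP.≤-Reasoning
  c : ℚ
  c = ι (numEdges adj) ÷₀ ι (count (inBlock part j))
  0≤c : 0ℚ ≤ℚ c
  0≤c = ÷₀-nonNeg (ι-nonNeg (numEdges adj)) (ι-nonNeg (count (inBlock part j)))
  z∈e : z u v ≡ u ⊎ z u v ≡ v
  z∈e = proj₁ (z-endpoint u v (∈-edges⇒adj adj e∈E))
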